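{- Let $\pi\in\hat{\mathfrak{S}}_n$ be a nonidentity permutation. Then the first descent of $\pi$ is a reduction pair in $\pi$, or the first descent of $\pi^{ -1}$ is a reduction pair in $\pi^{ -1}$ (or both).
   Context: $\hat{\mathfrak{S}}_n$ is the set of $\pi\in\mathfrak{S}_n$ avoiding the patterns $4231,35142,42513,351624$ (for $p\in\mathfrak{S}_m$ in one-line notation, $\pi$ avoids $p$ if there are no $i_1<\cdots<i_m$ with $i_a\pi<i_b\pi\iff ap<bp$ for all $a,b$). The rook diagram of $\sigma\in\mathfrak{S}_n$ has a rook in row $i$, column $i\sigma$ for each $i$; rows are numbered from top to bottom, columns from left to right; for a rook $x$, $x_i$ denotes its row and $x_j$ its column. The first descent of a nonidentity $\sigma$ is the pair of rooks $x,y$ of $\sigma$ with $x_i=\min\{i: i\sigma<(i-1)\sigma\}$ and $y_i=x_i-1$. A pair of rooks $x,y$ with $y_i=x_i-1$ and $x_j<y_j$ is a light reduction pair if there is no rook $a$ with $a_i<y_i$ and $a_j>y_j$, and no rook $a$ with $a_i>x_i$ and $x_j<a_j<y_j$. It is a heavy reduction pair if there is no rook $a$ with $a_i>x_i$ and $a_j<x_j$, no rook $a$ with $a_i<y_i$ and $a_j>y_j$, and no pair of rooks $a,b$ with $a_i<y_i$, $b_i>x_i$ and $x_j<a_j<b_j<y_j$. A reduction pair is a light or heavy reduction pair. -}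

module Defs where

open import Data.Nat using (ℕ; zero; suc)
import Data.Nat as ℕ
open import Data.Fin using (Fin; toℕ; _<_)
open import Data.Fin.Permutation using (Permutation′; _⟨$⟩ʳ_; flip)
open import Data.Vec using (Vec; lookup; [])
open import Data.Product using (Σ; ∃; ∃-syntax; _×_; _,_)
open import Data.Sum using (_⊎_)
open import Relation.Nullary using (¬_)
open import Relation.Binary.PropositionalEquality using (_≡_)
open import Function.Bundles using (_⇔_)

-- Rows and columns are indexed by Fin n (0-based; only the order matters).
-- The rook of σ in row i sits in column σ ⟨$⟩ʳ i (the paper's iσ).

-- A pattern p ∈ 𝔖_m in one-line notation, given as a vector of its values.
-- π contains p: there are positions i₁ < ⋯ < iₘ with
-- iₐπ < i_bπ  ⇔  ap < bp  for all a, b.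
Contains : ∀ {n m} → Permutation′ n → Vec ℕ m → Set
Contains {n} {m} π p =
  Σ (Fin m → Fin n) λ f →
    (∀ a b → a < b → f a < f b) ×
    (∀ a b → ((π ⟨$⟩ʳ f a) < (π ⟨$⟩ʳ f b)) ⇔ (lookup p a ℕ.< lookup p b))

Avoids : ∀ {n m} → Permutation′ n → Vec ℕ m → Set
Avoids π p = ¬ Contains π p

open import Data.Vec using (_∷_)

SHat : ∀ {n} → Permutation′ n → Set
SHat π =
  Avoids π (4 ∷ 2 ∷ 3 ∷ 1 ∷ []) ×
  Avoids π (3 ∷ 5 ∷ 1 ∷ 4 ∷ 2 ∷ []) ×
  Avoids π (4 ∷ 2 ∷ 5 ∷ 1 ∷ 3 ∷ []) ×
  Avoids π (3 ∷ 5 ∷ 1 ∷ 6 ∷ 2 ∷ 4 ∷ [])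

IsIdentity : ∀ {n} → Permutation′ n → Set
IsIdentity {n} σ = ∀ (i : Fin n) → σ ⟨$⟩ʳ i ≡ i

inv : ∀ {n} → Permutation′ n → Permutation′ n
inv = flip

Consecutive : ∀ {n} → Fin n → Fin n → Set
Consecutive y x = toℕ x ≡ suc (toℕ y)

IsFirstDescent : ∀ {n} → Permutation′ n → Fin n → Fin n → Set
IsFirstDescent {n} σ y x =
  Consecutive y x ×
  (σ ⟨$⟩ʳ x) < (σ ⟨$⟩ʳ y) ×
  (∀ (y' x' : Fin n) → Consecutive y' x' → (σ ⟨$⟩ʳ x') < (σ ⟨$⟩ʳ y') →
     ¬ (x' < x))

IsLightReductionPair : ∀ {n} → Permutation′ n → Fin n → Fin n → Set
IsLightReductionPair {n} σ y x =
  Consecutive y x ×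
  (σ ⟨$⟩ʳ x) < (σ ⟨$⟩ʳ y) ×
  (¬ (∃[ a ] (a < y × (σ ⟨$⟩ʳ y) < (σ ⟨$⟩ʳ a)))) ×
  (¬ (∃[ a ] (x < a × (σ ⟨$⟩ʳ x) < (σ ⟨$⟩ʳ a) × (σ ⟨$⟩ʳ a) < (σ ⟨$⟩ʳ y))))

IsHeavyReductionPair : ∀ {n} → Permutation′ n → Fin n → Fin n → Set
IsHeavyReductionPair {n} σ y x =
  Consecutive y x ×
  (σ ⟨$⟩ʳ x) < (σ ⟨$⟩ʳ y) ×
  (¬ (∃[ a ] (x < a × (σ ⟨$⟩ʳ a) < (σ ⟨$⟩ʳ x)))) ×
  (¬ (∃[ a ] (a < y × (σ ⟨$⟩ʳ y) < (σ ⟨$⟩ʳ a)))) ×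
  (¬ (∃[ a ] ∃[ b ] (a < y × x < b ×
       (σ ⟨$⟩ʳ x) < (σ ⟨$⟩ʳ a) × (σ ⟨$⟩ʳ a) < (σ ⟨$⟩ʳ b) ×
       (σ ⟨$⟩ʳ b) < (σ ⟨$⟩ʳ y))))

IsReductionPair : ∀ {n} → Permutation′ n → Fin n → Fin n → Set
IsReductionPair σ y x = IsLightReductionPair σ y x ⊎ IsHeavyReductionPair σ y x

FirstDescentIsReductionPair : ∀ {n} → Permutation′ n → Set
FirstDescentIsReductionPair {n} σ =
  ∃[ y ] ∃[ x ] (IsFirstDescent σ y x × IsReductionPair σ y x)

-- Write σ for π and τ for π⁻¹, with first descents (y, x) and (y′, x′). Since σ increases on
-- the rows above x, no rook above y lies right of σ y; so (y, x) fails to be a reduction pair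
-- only if some rook below x has its column strictly between σ x and σ y and, in addition,
-- either some rook below x lies left of σ x or there is a middle pair across the descent.
-- The same holds for τ at (y′, x′). As τ increases on the rows above x′, every combination of
-- such obstructions for σ and for τ fixes enough of the relative order of the rooks involved
-- to produce an occurrence of 4231, 35142, 42513 or 351624 in π. These four patterns are
-- involutions, so 𝔖̂ is closed under inversion and the two mixed combinations are symmetric.

module Submission where

open import Defs
open import Data.Nat using (ℕ; suc; z≤n; s≤s)
import Data.Nat as ℕ
import Data.Nat.Properties as ℕP
open import Data.Fin using (Fin; zero; suc; toℕ; _<_; _≤_; inject₁; fromℕ<; #_)
import Data.Fin.Properties as FP
open import Data.Fin.Induction using (<-weakInduction)
open import Data.Fin.Permutation using (Permutation′; _⟨$⟩ʳ_; _⟨$⟩ˡ_; inverseˡ; inverseʳ)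
open import Data.Vec using (Vec; lookup; map; []; _∷_)
open import Data.Vec.Properties using (lookup-map)
open import Data.Product using (∃-syntax; _×_; _,_; proj₁; proj₂)
open import Data.Sum using (_⊎_; inj₁; inj₂; [_,_]′)
open import Data.Empty using (⊥; ⊥-elim)
open import Function using (_∘_)
open import Function.Bundles using (mk⇔; Equivalence)
open import Relation.Binary.Core using (_Preserves_⟶_)
open import Relation.Binary.Definitions using (Tri; tri<; tri≈; tri>)
open import Relation.Binary.PropositionalEquality using (_≡_; refl; sym; trans; cong; subst; subst₂)
open import Relation.Nullary using (¬_; Dec; yes; no)
open import Relation.Nullary.Decidable using (True; toWitness; from-yes; ¬?; decidable-stable; _×-dec_)

consecutive-inject₁ : ∀ {n} (i : Fin n) → Consecutive (inject₁ i) (suc i)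
consecutive-inject₁ i = cong suc (sym (FP.toℕ-inject₁ i))

ascending-below : ∀ {m n} (g : Fin m → Fin n) (B : ℕ) →
  (∀ {k l} → Consecutive k l → toℕ l ℕ.< B → g k < g l) →
  ∀ {a b} → a < b → toℕ b ℕ.< B → g a < g b
ascending-below {suc m} g B step {b = b} = <-weakInduction P (λ ()) extend b
  where
  P : Fin (suc m) → Set
  P b = ∀ {a} → a < b → toℕ b ℕ.< B → g a < g b
  extend : ∀ i → P (inject₁ i) → P (suc i)
  extend i below-i {a} a<1+i 1+i<B =
    [ (λ a<i → FP.<-trans (below-i a<i i<B) i↗1+i)
    , (λ a≡i → subst (λ a → g a < g (suc i)) (sym (FP.toℕ-injective a≡i)) i↗1+i)
    ]′ (ℕP.m≤n⇒m<n∨m≡n (FP.<⇒≤pred a<1+i))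
    where
    i↗1+i : g (inject₁ i) < g (suc i)
    i↗1+i = step (consecutive-inject₁ i) 1+i<B
    i<B : toℕ (inject₁ i) ℕ.< B
    i<B = ℕP.<-trans (FP.≤̄⇒inject₁< FP.≤-refl) 1+i<B

ascending-of-steps : ∀ {m n} (g : Fin (suc m) → Fin n) →
  (∀ k → g (inject₁ k) < g (suc k)) → g Preserves _<_ ⟶ _<_
ascending-of-steps {m} g steps a<b = ascending-below g (suc m) step a<b (FP.toℕ<n _)
  where
  step : ∀ {k l} → Consecutive k l → toℕ l ℕ.< suc m → g k < g l
  step {k} {suc l} 1+l≡1+k _ = subst (λ k → g k < g (suc l)) l≡k (steps l)
    where l≡k = FP.toℕ-injective (trans (FP.toℕ-inject₁ l) (ℕP.suc-injective 1+l≡1+k))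

ascending-reflects : ∀ {m n} {g : Fin m → Fin n} → g Preserves _<_ ⟶ _<_ →
  ∀ {a b} → g a < g b → a < b
ascending-reflects g↑ {a} {b} ga<gb with FP.<-cmp a b
... | tri< a<b _ _ = a<b
... | tri≈ _ refl _ = ⊥-elim (FP.<-irrefl refl ga<gb)
... | tri> _ _ b<a = ⊥-elim (FP.<-asym ga<gb (g↑ b<a))

ascending⇒≤ : ∀ {m n} (g : Fin m → Fin n) → g Preserves _<_ ⟶ _<_ → ∀ i → toℕ i ℕ.≤ toℕ (g i)
ascending⇒≤ {suc m} g g↑ = <-weakInduction (λ i → toℕ i ℕ.≤ toℕ (g i)) z≤n extend
  where
  extend : ∀ i → toℕ (inject₁ i) ℕ.≤ toℕ (g (inject₁ i)) → suc (toℕ i) ℕ.≤ toℕ (g (suc i))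
  extend i ih = ℕP.≤-trans (s≤s (subst (ℕ._≤ toℕ (g (inject₁ i))) (FP.toℕ-inject₁ i) ih))
                          (g↑ (FP.≤̄⇒inject₁< FP.≤-refl))

ascending-permutation-is-identity : ∀ {n} (π : Permutation′ n) →
  (π ⟨$⟩ʳ_) Preserves _<_ ⟶ _<_ → IsIdentity π
ascending-permutation-is-identity π σ↑ i =
  FP.toℕ-injective (ℕP.≤-antisym σi≤i (ascending⇒≤ _ σ↑ i))
  where
  τ↑ : (π ⟨$⟩ˡ_) Preserves _<_ ⟶ _<_
  τ↑ a<b = ascending-reflects σ↑ (subst₂ _<_ (sym (inverseʳ π)) (sym (inverseʳ π)) a<b)
  σi≤i : toℕ (π ⟨$⟩ʳ i) ℕ.≤ toℕ i
  σi≤i = subst (λ j → toℕ (π ⟨$⟩ʳ i) ℕ.≤ toℕ j) (inverseˡ π) (ascending⇒≤ _ τ↑ (π ⟨$⟩ʳ i))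

DescentAt : ∀ {n} → Permutation′ n → Fin n → Set
DescentAt π x = ∃[ y ] (Consecutive y x × π ⟨$⟩ʳ x < π ⟨$⟩ʳ y)

descentAt? : ∀ {n} (π : Permutation′ n) x → Dec (DescentAt π x)
descentAt? π x = FP.any? λ y → (toℕ x ℕ.≟ suc (toℕ y)) ×-dec (π ⟨$⟩ʳ x FP.<? π ⟨$⟩ʳ y)

ascending-below-descents : ∀ {n} (π : Permutation′ n) (B : ℕ) →
  (∀ {l} → toℕ l ℕ.< B → ¬ DescentAt π l) →
  ∀ {a b} → a < b → toℕ b ℕ.< B → π ⟨$⟩ʳ a < π ⟨$⟩ʳ b
ascending-below-descents π B no-descent = ascending-below (π ⟨$⟩ʳ_) B step
  where
  step : ∀ {k l} → Consecutive k l → toℕ l ℕ.< B → π ⟨$⟩ʳ k < π ⟨$⟩ʳ l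
  step {k} {l} k→l l<B with FP.<-cmp (π ⟨$⟩ʳ k) (π ⟨$⟩ʳ l)
  ... | tri< σk<σl _ _ = σk<σl
  ... | tri≈ _ σk≡σl _ = ⊥-elim (ℕP.1+n≢n (trans (sym k→l) (cong toℕ (sym k≡l))))
    where k≡l = trans (sym (inverseˡ π)) (trans (cong (π ⟨$⟩ˡ_) σk≡σl) (inverseˡ π))
  ... | tri> _ _ σl<σk = ⊥-elim (no-descent l<B (k , k→l , σl<σk))

first-descent : ∀ {n} (π : Permutation′ n) → ¬ IsIdentity π → ∃[ y ] ∃[ x ] IsFirstDescent π y x
first-descent {n} π non-identity
  with FP.¬∀⟶∃¬-smallest n (¬_ ∘ DescentAt π) (¬? ∘ descentAt? π) some-descent
  where
  some-descent : ¬ (∀ x → ¬ DescentAt π x)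
  some-descent no-descent = non-identity (ascending-permutation-is-identity π λ a<b →
    ascending-below-descents π n (λ _ → no-descent _) a<b (FP.toℕ<n _))
... | x , ¬¬descent , earlier
  with decidable-stable (descentAt? π x) ¬¬descent
... | y , y→x , σx<σy = y , x , y→x , σx<σy , minimal
  where
  minimal : ∀ y′ x′ → Consecutive y′ x′ → π ⟨$⟩ʳ x′ < π ⟨$⟩ʳ y′ → ¬ (x′ < x)
  minimal y′ x′ y′→x′ σx′<σy′ x′<x =
    earlier (fromℕ< x′<x) (subst (DescentAt π) (sym x′≡) (y′ , y′→x′ , σx′<σy′))
    where x′≡ = FP.toℕ-injective (trans (FP.toℕ-inject (fromℕ< x′<x)) (FP.toℕ-fromℕ< x′<x))

oneLine : ∀ {m} → Vec (Fin m) m → Vec ℕ m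
oneLine = map (λ i → suc (toℕ i))

Involutive : ∀ {m} → Vec (Fin m) m → Set
Involutive {m} r = ∀ (a : Fin m) → lookup r (lookup r a) ≡ a

involutive? : ∀ {m} (r : Vec (Fin m) m) → Dec (Involutive r)
involutive? r = FP.all? λ a → lookup r (lookup r a) FP.≟ a

oneLine-< : ∀ {m} (r : Vec (Fin m) m) {a b} →
  lookup (oneLine r) a ℕ.< lookup (oneLine r) b → lookup r a < lookup r b
oneLine-< r {a} {b} = ℕ.s≤s⁻¹ ∘ subst₂ ℕ._<_ (lookup-map a _ r) (lookup-map b _ r)

<-oneLine : ∀ {m} (r : Vec (Fin m) m) {a b} →
  lookup r a < lookup r b → lookup (oneLine r) a ℕ.< lookup (oneLine r) b
<-oneLine r {a} {b} = subst₂ ℕ._<_ (sym (lookup-map a _ r)) (sym (lookup-map b _ r)) ∘ s≤s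

-- The pattern is oneLine r, and byValue k is the position of its (k+1)-st smallest entry.
contains-by-value : ∀ {m n} (π : Permutation′ n) (r : Vec (Fin m) m)
  (byValue : Fin m → Fin m) → (∀ a → byValue (lookup r a) ≡ a) →
  (f : Fin m → Fin n) → f Preserves _<_ ⟶ _<_ →
  (λ k → π ⟨$⟩ʳ f (byValue k)) Preserves _<_ ⟶ _<_ →
  Contains π (oneLine r)
contains-by-value π r byValue byValue∘r f f↑ h↑ = f , (λ _ _ → f↑) , λ a b →
  mk⇔ (<-oneLine r ∘ ascending-reflects h↑ ∘ subst₂ _<_ (sym (h∘r a)) (sym (h∘r b)))
      (subst₂ _<_ (h∘r a) (h∘r b) ∘ h↑ ∘ oneLine-< r)
  where
  h∘r : ∀ a → π ⟨$⟩ʳ f (byValue (lookup r a)) ≡ π ⟨$⟩ʳ f a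
  h∘r a = cong (λ i → π ⟨$⟩ʳ f i) (byValue∘r a)

contains-inverse : ∀ {m n} (π : Permutation′ n) (r : Vec (Fin m) m) → Involutive r →
  Contains (inv π) (oneLine r) → Contains π (oneLine r)
contains-inverse {m} {n} π r r-involutive (f , f↑ , τf-order) =
  contains-by-value π r (lookup r) r-involutive g g↑ σg↑
  where
  g : Fin m → Fin n
  g k = π ⟨$⟩ˡ f (lookup r k)
  g↑ : g Preserves _<_ ⟶ _<_
  g↑ {k} {l} k<l = Equivalence.from (τf-order (lookup r k) (lookup r l))
    (<-oneLine r (subst₂ _<_ (sym (r-involutive k)) (sym (r-involutive l)) k<l))
  σg↑ : (λ k → π ⟨$⟩ʳ g (lookup r k)) Preserves _<_ ⟶ _<_
  σg↑ {k} {l} k<l = subst₂ _<_ (sym (σg≡f k)) (sym (σg≡f l)) (f↑ k l k<l)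
    where
    σg≡f : ∀ k → π ⟨$⟩ʳ g (lookup r k) ≡ f k
    σg≡f k = trans (inverseʳ π) (cong f (r-involutive k))

rank4231 : Vec (Fin 4) 4
rank4231 = # 3 ∷ # 1 ∷ # 2 ∷ # 0 ∷ []

rank35142 : Vec (Fin 5) 5
rank35142 = # 2 ∷ # 4 ∷ # 0 ∷ # 3 ∷ # 1 ∷ []

rank42513 : Vec (Fin 5) 5
rank42513 = # 3 ∷ # 1 ∷ # 4 ∷ # 0 ∷ # 2 ∷ []

rank351624 : Vec (Fin 6) 6
rank351624 = # 2 ∷ # 4 ∷ # 0 ∷ # 5 ∷ # 1 ∷ # 3 ∷ []

SHat-inv : ∀ {n} {π : Permutation′ n} → SHat π → SHat (inv π)
SHat-inv {π = π} (a₁ , a₂ , a₃ , a₄) =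
  a₁ ∘ contains-inverse π rank4231 (from-yes (involutive? rank4231)) ,
  a₂ ∘ contains-inverse π rank35142 (from-yes (involutive? rank35142)) ,
  a₃ ∘ contains-inverse π rank42513 (from-yes (involutive? rank42513)) ,
  a₄ ∘ contains-inverse π rank351624 (from-yes (involutive? rank351624))

module Occurrences {n} (π : Permutation′ n) where

  private
    σ : Fin n → Fin n
    σ = π ⟨$⟩ʳ_

    occurrence : ∀ {m} (r : Vec (Fin (suc m)) (suc m)) {r-involutive : True (involutive? r)}
      (f : Fin (suc m) → Fin n) → (∀ k → f (inject₁ k) < f (suc k)) →
      (∀ k → σ (f (lookup r (inject₁ k))) < σ (f (lookup r (suc k)))) →
      Contains π (oneLine r)
    occurrence r {r-involutive} f f-steps σf-steps =
      contains-by-value π r (lookup r) (toWitness r-involutive) f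
        (ascending-of-steps f f-steps) (ascending-of-steps (λ k → σ (f (lookup r k))) σf-steps)

  contains4231 : ∀ {i₁ i₂ i₃ i₄} → i₁ < i₂ → i₂ < i₃ → i₃ < i₄ →
    σ i₄ < σ i₂ → σ i₂ < σ i₃ → σ i₃ < σ i₁ → Contains π (4 ∷ 2 ∷ 3 ∷ 1 ∷ [])
  contains4231 {i₁} {i₂} {i₃} {i₄} r₁ r₂ r₃ v₁ v₂ v₃ =
    occurrence rank4231 (lookup (i₁ ∷ i₂ ∷ i₃ ∷ i₄ ∷ []))
      (λ { zero → r₁ ; (suc zero) → r₂ ; (suc (suc zero)) → r₃ })
      (λ { zero → v₁ ; (suc zero) → v₂ ; (suc (suc zero)) → v₃ })

  contains35142 : ∀ {i₁ i₂ i₃ i₄ i₅} → i₁ < i₂ → i₂ < i₃ → i₃ < i₄ → i₄ < i₅ →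
    σ i₃ < σ i₅ → σ i₅ < σ i₁ → σ i₁ < σ i₄ → σ i₄ < σ i₂ →
    Contains π (3 ∷ 5 ∷ 1 ∷ 4 ∷ 2 ∷ [])
  contains35142 {i₁} {i₂} {i₃} {i₄} {i₅} r₁ r₂ r₃ r₄ v₁ v₂ v₃ v₄ =
    occurrence rank35142 (lookup (i₁ ∷ i₂ ∷ i₃ ∷ i₄ ∷ i₅ ∷ []))
      (λ { zero → r₁ ; (suc zero) → r₂ ; (suc (suc zero)) → r₃ ; (suc (suc (suc zero))) → r₄ })
      (λ { zero → v₁ ; (suc zero) → v₂ ; (suc (suc zero)) → v₃ ; (suc (suc (suc zero))) → v₄ })

  contains42513 : ∀ {i₁ i₂ i₃ i₄ i₅} → i₁ < i₂ → i₂ < i₃ → i₃ < i₄ → i₄ < i₅ →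
    σ i₄ < σ i₂ → σ i₂ < σ i₅ → σ i₅ < σ i₁ → σ i₁ < σ i₃ →
    Contains π (4 ∷ 2 ∷ 5 ∷ 1 ∷ 3 ∷ [])
  contains42513 {i₁} {i₂} {i₃} {i₄} {i₅} r₁ r₂ r₃ r₄ v₁ v₂ v₃ v₄ =
    occurrence rank42513 (lookup (i₁ ∷ i₂ ∷ i₃ ∷ i₄ ∷ i₅ ∷ []))
      (λ { zero → r₁ ; (suc zero) → r₂ ; (suc (suc zero)) → r₃ ; (suc (suc (suc zero))) → r₄ })
      (λ { zero → v₁ ; (suc zero) → v₂ ; (suc (suc zero)) → v₃ ; (suc (suc (suc zero))) → v₄ })

  contains351624 : ∀ {i₁ i₂ i₃ i₄ i₅ i₆} →
    i₁ < i₂ → i₂ < i₃ → i₃ < i₄ → i₄ < i₅ → i₅ < i₆ →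
    σ i₃ < σ i₅ → σ i₅ < σ i₁ → σ i₁ < σ i₆ → σ i₆ < σ i₂ → σ i₂ < σ i₄ →
    Contains π (3 ∷ 5 ∷ 1 ∷ 6 ∷ 2 ∷ 4 ∷ [])
  contains351624 {i₁} {i₂} {i₃} {i₄} {i₅} {i₆} r₁ r₂ r₃ r₄ r₅ v₁ v₂ v₃ v₄ v₅ =
    occurrence rank351624 (lookup (i₁ ∷ i₂ ∷ i₃ ∷ i₄ ∷ i₅ ∷ i₆ ∷ []))
      (λ { zero → r₁ ; (suc zero) → r₂ ; (suc (suc zero)) → r₃
         ; (suc (suc (suc zero))) → r₄ ; (suc (suc (suc (suc zero)))) → r₅ })
      (λ { zero → v₁ ; (suc zero) → v₂ ; (suc (suc zero)) → v₃
         ; (suc (suc (suc zero))) → v₄ ; (suc (suc (suc (suc zero)))) → v₅ })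

LeftRookBelow : ∀ {n} → Permutation′ n → Fin n → Set
LeftRookBelow π x = ∃[ a ] (x < a × π ⟨$⟩ʳ a < π ⟨$⟩ʳ x)

MiddleRookBelow : ∀ {n} → Permutation′ n → Fin n → Fin n → Set
MiddleRookBelow π y x = ∃[ a ] (x < a × π ⟨$⟩ʳ x < π ⟨$⟩ʳ a × π ⟨$⟩ʳ a < π ⟨$⟩ʳ y)

MiddlePairAcross : ∀ {n} → Permutation′ n → Fin n → Fin n → Set
MiddlePairAcross π y x = ∃[ a ] ∃[ b ] (a < y × x < b ×
  π ⟨$⟩ʳ x < π ⟨$⟩ʳ a × π ⟨$⟩ʳ a < π ⟨$⟩ʳ b × π ⟨$⟩ʳ b < π ⟨$⟩ʳ y)

leftRookBelow? : ∀ {n} (π : Permutation′ n) x → Dec (LeftRookBelow π x)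
leftRookBelow? π x = FP.any? λ a → (x FP.<? a) ×-dec (π ⟨$⟩ʳ a FP.<? π ⟨$⟩ʳ x)

middleRookBelow? : ∀ {n} (π : Permutation′ n) y x → Dec (MiddleRookBelow π y x)
middleRookBelow? π y x = FP.any? λ a →
  (x FP.<? a) ×-dec (π ⟨$⟩ʳ x FP.<? π ⟨$⟩ʳ a) ×-dec (π ⟨$⟩ʳ a FP.<? π ⟨$⟩ʳ y)

middlePairAcross? : ∀ {n} (π : Permutation′ n) y x → Dec (MiddlePairAcross π y x)
middlePairAcross? π y x = FP.any? λ a → FP.any? λ b →
  (a FP.<? y) ×-dec (x FP.<? b) ×-dec (π ⟨$⟩ʳ x FP.<? π ⟨$⟩ʳ a) ×-dec
  (π ⟨$⟩ʳ a FP.<? π ⟨$⟩ʳ b) ×-dec (π ⟨$⟩ʳ b FP.<? π ⟨$⟩ʳ y)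

ReductionObstruction : ∀ {n} → Permutation′ n → Fin n → Fin n → Set
ReductionObstruction π y x = MiddleRookBelow π y x ×
  (LeftRookBelow π x ⊎ ¬ LeftRookBelow π x × MiddlePairAcross π y x)

<-consecutive : ∀ {n} {y x a : Fin n} → Consecutive y x → a < x → a ≤ y
<-consecutive {a = a} y→x a<x = ℕ.s≤s⁻¹ (subst (toℕ a ℕ.<_) y→x a<x)

module FirstDescent {n} (π : Permutation′ n) {y x : Fin n} (fd : IsFirstDescent π y x) where

  private
    σ : Fin n → Fin n
    σ = π ⟨$⟩ʳ_

  y→x : Consecutive y x
  y→x = proj₁ fd

  y<x : y < x
  y<x = ℕP.≤-reflexive (sym y→x)

  σx<σy : σ x < σ y
  σx<σy = proj₁ (proj₂ fd)

  ascending-before : ∀ {a b} → a < b → b < x → σ a < σ b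
  ascending-before = ascending-below-descents π (toℕ x)
    λ l<x (k , k→l , σl<σk) → proj₂ (proj₂ fd) k _ k→l σl<σk l<x

  no-higher-rook-above : ¬ (∃[ a ] (a < y × σ y < σ a))
  no-higher-rook-above (a , a<y , σy<σa) = FP.<-asym σy<σa (ascending-before a<y y<x)

  reduction-pair-or-obstruction : IsReductionPair π y x ⊎ ReductionObstruction π y x
  reduction-pair-or-obstruction with middleRookBelow? π y x
  ... | no ¬middle = inj₁ (inj₁ (y→x , σx<σy , no-higher-rook-above , ¬middle))
  ... | yes middle with leftRookBelow? π x | middlePairAcross? π y x
  ...   | yes left | _ = inj₂ (middle , inj₁ left)
  ...   | no ¬left | yes pair = inj₂ (middle , inj₂ (¬left , pair))
  ...   | no ¬left | no ¬pair =
          inj₁ (inj₂ (y→x , σx<σy , ¬left , no-higher-rook-above , ¬pair))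

module FirstDescents {n} (π : Permutation′ n) {y x y′ x′ : Fin n}
  (fd : IsFirstDescent π y x) (fd′ : IsFirstDescent (inv π) y′ x′) where

  private
    σ τ : Fin n → Fin n
    σ = π ⟨$⟩ʳ_
    τ = π ⟨$⟩ˡ_

  open FirstDescent π fd public using (y→x; y<x; σx<σy)
  open FirstDescent (inv π) fd′ public using ()
    renaming (y→x to y′→x′; y<x to y′<x′; ascending-before to τ-ascending-before)

  στ-< : ∀ {a b} → a < b → σ (τ a) < σ (τ b)
  στ-< = subst₂ _<_ (sym (inverseʳ π)) (sym (inverseʳ π))

  στ-<ˡ : ∀ {a i} → a < σ i → σ (τ a) < σ i
  στ-<ˡ = subst (_< _) (sym (inverseʳ π))

  στ-<ʳ : ∀ {a i} → σ i < a → σ i < σ (τ a)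
  στ-<ʳ = subst (_ <_) (sym (inverseʳ π))

  inversion⇒x′≤ : ∀ {a b} → a < b → σ b < σ a → x′ ≤ σ a
  inversion⇒x′≤ a<b σb<σa = ℕP.≮⇒≥ λ σa<x′ →
    FP.<-asym a<b (subst₂ _<_ (inverseˡ π) (inverseˡ π) (τ-ascending-before σb<σa σa<x′))

  ¬left⇒τx′<x : ¬ LeftRookBelow (inv π) x′ → τ x′ < x
  ¬left⇒τx′<x ¬left = ℕP.≰⇒> λ x≤τx′ → compare x≤τx′ (FP.<-cmp x′ (σ y))
    where
    compare : x ≤ τ x′ → Tri (x′ < σ y) (x′ ≡ σ y) (σ y < x′) → ⊥
    compare x≤τx′ (tri< x′<σy _ _) =
      ¬left (σ y , x′<σy , subst (_< τ x′) (sym (inverseˡ π)) (ℕP.<-≤-trans y<x x≤τx′))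
    compare x≤τx′ (tri≈ _ x′≡σy _) =
      ℕP.<⇒≱ y<x (subst (x ≤_) (trans (cong τ x′≡σy) (inverseˡ π)) x≤τx′)
    compare x≤τx′ (tri> _ _ σy<x′) = ℕP.<⇒≱ σy<x′ (inversion⇒x′≤ y<x σx<σy)

  τx′<x∧x′<σy⇒τx′<y : τ x′ < x → x′ < σ y → τ x′ < y
  τx′<x∧x′<σy⇒τx′<y τx′<x x′<σy =
    FP.≤∧≢⇒< (<-consecutive y→x τx′<x) λ τx′≡y → FP.<-irrefl (cong σ τx′≡y) (στ-<ˡ x′<σy)

module Incompatibility {n} (π : Permutation′ n) (shat : SHat π) {y x y′ x′ : Fin n}
  (fd : IsFirstDescent π y x) (fd′ : IsFirstDescent (inv π) y′ x′) where

  private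
    σ τ : Fin n → Fin n
    σ = π ⟨$⟩ʳ_
    τ = π ⟨$⟩ˡ_

  open FirstDescents π fd fd′
  module D′ = FirstDescents (inv π) fd′ fd
  open Occurrences π

  private
    no4231 : ¬ Contains π (4 ∷ 2 ∷ 3 ∷ 1 ∷ [])
    no4231 = proj₁ shat
    no35142 : ¬ Contains π (3 ∷ 5 ∷ 1 ∷ 4 ∷ 2 ∷ [])
    no35142 = proj₁ (proj₂ shat)
    no42513 : ¬ Contains π (4 ∷ 2 ∷ 5 ∷ 1 ∷ 3 ∷ [])
    no42513 = proj₁ (proj₂ (proj₂ shat))
    no351624 : ¬ Contains π (3 ∷ 5 ∷ 1 ∷ 6 ∷ 2 ∷ 4 ∷ [])
    no351624 = proj₂ (proj₂ (proj₂ shat))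

  middle-rook-beyond-τy′ : ∀ {a} → x < a → σ x < σ a → σ a < σ y → y′ < σ x → τ y′ < a
  middle-rook-beyond-τy′ {a} x<a σx<σa σa<σy y′<σx with FP.<-cmp a (τ y′)
  ... | tri< a<τy′ _ _ =
        ⊥-elim (no4231 (contains4231 y<x x<a a<τy′ (στ-<ˡ y′<σx) σx<σa σa<σy))
  ... | tri≈ _ refl _ = ⊥-elim (FP.<-asym y′<σx (subst (σ x <_) (inverseʳ π) σx<σa))
  ... | tri> _ _ τy′<a = τy′<a

  middle-rooks-excluded : LeftRookBelow π x → LeftRookBelow (inv π) x′ →
    MiddleRookBelow π y x → MiddleRookBelow (inv π) y′ x′ → ⊥
  middle-rooks-excluded (b , x<b , σb<σx) (b′ , x′<b′ , τb′<τx′)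
    (a , x<a , σx<σa , σa<σy) (t , x′<t , τx′<τt , τt<τy′) = compare (FP.<-cmp t (σ y))
    where
    x′≤σx : x′ ≤ σ x
    x′≤σx = inversion⇒x′≤ x<b σb<σx
    x≤τx′ : x ≤ τ x′
    x≤τx′ = D′.inversion⇒x′≤ x′<b′ τb′<τx′
    y′<σx : y′ < σ x
    y′<σx = ℕP.<-≤-trans y′<x′ x′≤σx
    compare : Tri (t < σ y) (t ≡ σ y) (σ y < t) → ⊥
    compare (tri< t<σy _ _) = no4231 (contains4231 (ℕP.<-≤-trans y<x x≤τx′) τx′<τt τt<τy′
      (στ-< y′<x′) (στ-< x′<t) (στ-<ˡ t<σy))
    compare (tri≈ _ t≡σy _) = FP.<-asym (ℕP.<-≤-trans y<x x≤τx′)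
      (subst (τ x′ <_) (trans (cong τ t≡σy) (inverseˡ π)) τx′<τt)
    compare (tri> _ _ σy<t) = no42513 (contains42513 y<x (ℕP.≤-<-trans x≤τx′ τx′<τt) τt<τy′
      (middle-rook-beyond-τy′ x<a σx<σa σa<σy y′<σx)
      (στ-<ˡ y′<σx) σx<σa σa<σy (στ-<ʳ σy<t))

  middle-rook-and-pair-excluded : LeftRookBelow π x → ¬ LeftRookBelow (inv π) x′ →
    MiddleRookBelow π y x → MiddlePairAcross (inv π) y′ x′ → ⊥
  middle-rook-and-pair-excluded (b , x<b , σb<σx) ¬left′ (a , x<a , σx<σa , σa<σy)
    (a′ , b′ , a′<y′ , x′<b′ , τx′<τa′ , τa′<τb′ , τb′<τy′) = compare (FP.<-cmp b′ (σ y))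
    where
    x′≤σx : x′ ≤ σ x
    x′≤σx = inversion⇒x′≤ x<b σb<σx
    τx′<y : τ x′ < y
    τx′<y = τx′<x∧x′<σy⇒τx′<y (¬left⇒τx′<x ¬left′) (ℕP.≤-<-trans x′≤σx σx<σy)
    y<τa′ : y < τ a′
    y<τa′ = ℕP.<-≤-trans y<x (D′.inversion⇒x′≤ (FP.<-trans a′<y′ y′<x′) τx′<τa′)
    compare : Tri (b′ < σ y) (b′ ≡ σ y) (σ y < b′) → ⊥
    compare (tri< b′<σy _ _) = no35142 (contains35142 τx′<y y<τa′ τa′<τb′ τb′<τy′
      (στ-< a′<y′) (στ-< y′<x′) (στ-< x′<b′) (στ-<ˡ b′<σy))
    compare (tri≈ _ b′≡σy _) =
      FP.<-irrefl (sym (trans (cong τ b′≡σy) (inverseˡ π))) (FP.<-trans y<τa′ τa′<τb′)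
    compare (tri> _ _ σy<b′) = no351624 (contains351624 τx′<y y<τa′ τa′<τb′ τb′<τy′
      (middle-rook-beyond-τy′ x<a σx<σa σa<σy (ℕP.<-≤-trans y′<x′ x′≤σx))
      (στ-< a′<y′) (στ-< y′<x′) (στ-<ˡ (ℕP.≤-<-trans x′≤σx σx<σa)) σa<σy (στ-<ʳ σy<b′))

  middle-pairs-excluded : ¬ LeftRookBelow π x → ¬ LeftRookBelow (inv π) x′ →
    MiddlePairAcross π y x → MiddlePairAcross (inv π) y′ x′ → ⊥
  middle-pairs-excluded ¬left ¬left′ (a , b , a<y , x<b , σx<σa , σa<σb , σb<σy)
    (a′ , b′ , a′<y′ , x′<b′ , τx′<τa′ , τa′<τb′ , τb′<τy′) = compare-b′ (FP.<-cmp b′ (σ y))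
    where
    x′<σb : x′ < σ b
    x′<σb = ℕP.≤-<-trans (inversion⇒x′≤ (FP.<-trans a<y y<x) σx<σa) σa<σb
    τx′<y : τ x′ < y
    τx′<y = τx′<x∧x′<σy⇒τx′<y (¬left⇒τx′<x ¬left′) (FP.<-trans x′<σb σb<σy)
    x<τb′ : x < τ b′
    x<τb′ = ℕP.≤-<-trans (D′.inversion⇒x′≤ (FP.<-trans a′<y′ y′<x′) τx′<τa′) τa′<τb′
    σx<y′ : σ x < y′
    σx<y′ = FP.≤∧≢⇒< (<-consecutive y′→x′ (D′.¬left⇒τx′<x ¬left)) λ σx≡y′ →
      FP.<-irrefl (sym (trans (cong τ (sym σx≡y′)) (inverseˡ π))) (FP.<-trans x<τb′ τb′<τy′)
    compare-b : Tri (b < τ y′) (b ≡ τ y′) (τ y′ < b) → σ y < b′ → ⊥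
    compare-b (tri< b<τy′ _ _) _ = no35142 (contains35142 τx′<y y<x x<b b<τy′
      (στ-<ʳ σx<y′) (στ-< y′<x′) (στ-<ˡ x′<σb) σb<σy)
    compare-b (tri≈ _ b≡τy′ _) _ =
      FP.<-asym y′<x′ (subst (x′ <_) (trans (cong σ b≡τy′) (inverseʳ π)) x′<σb)
    compare-b (tri> _ _ τy′<b) σy<b′ = no351624 (contains351624 τx′<y y<x x<τb′ τb′<τy′ τy′<b
      (στ-<ʳ σx<y′) (στ-< y′<x′) (στ-<ˡ x′<σb) σb<σy (στ-<ʳ σy<b′))
    compare-b′ : Tri (b′ < σ y) (b′ ≡ σ y) (σ y < b′) → ⊥
    compare-b′ (tri< b′<σy _ _) = no35142 (contains35142 τx′<y y<x x<τb′ τb′<τy′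
      (στ-<ʳ σx<y′) (στ-< y′<x′) (στ-< x′<b′) (στ-<ˡ b′<σy))
    compare-b′ (tri≈ _ b′≡σy _) =
      FP.<-asym y<x (subst (x <_) (trans (cong τ b′≡σy) (inverseˡ π)) x<τb′)
    compare-b′ (tri> _ _ σy<b′) = compare-b (FP.<-cmp b (τ y′)) σy<b′

obstructions-incompatible : ∀ {n} {π : Permutation′ n} → SHat π → ∀ {y x y′ x′} →
  IsFirstDescent π y x → IsFirstDescent (inv π) y′ x′ →
  ReductionObstruction π y x → ReductionObstruction (inv π) y′ x′ → ⊥
obstructions-incompatible {π = π} shat fd fd′ (middle , inj₁ left) (middle′ , inj₁ left′) =
  Incompatibility.middle-rooks-excluded π shat fd fd′ left left′ middle middle′
obstructions-incompatible {π = π} shat fd fd′ (middle , inj₁ left) (_ , inj₂ (¬left′ , pair′)) =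
  Incompatibility.middle-rook-and-pair-excluded π shat fd fd′ left ¬left′ middle pair′
obstructions-incompatible {π = π} shat fd fd′ (_ , inj₂ (¬left , pair)) (middle′ , inj₁ left′) =
  Incompatibility.middle-rook-and-pair-excluded (inv π) (SHat-inv {π = π} shat) fd′ fd
    left′ ¬left middle′ pair
obstructions-incompatible {π = π} shat fd fd′
  (_ , inj₂ (¬left , pair)) (_ , inj₂ (¬left′ , pair′)) =
  Incompatibility.middle-pairs-excluded π shat fd fd′ ¬left ¬left′ pair pair′

identity-of-inverse : ∀ {n} (π : Permutation′ n) → IsIdentity (inv π) → IsIdentity π
identity-of-inverse π inv-identity i = trans (cong (π ⟨$⟩ʳ_) (sym (inv-identity i))) (inverseʳ π)

proposition5p6 : (n : ℕ) (π : Permutation′ n) → SHat π → ¬ IsIdentity π →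
    FirstDescentIsReductionPair π ⊎ FirstDescentIsReductionPair (inv π)
proposition5p6 n π shat non-identity
  with first-descent π non-identity
     | first-descent (inv π) (non-identity ∘ identity-of-inverse π)
... | y , x , fd | y′ , x′ , fd′
  with FirstDescent.reduction-pair-or-obstruction π fd
     | FirstDescent.reduction-pair-or-obstruction (inv π) fd′
... | inj₁ reduction | _ = inj₁ (y , x , fd , reduction)
... | inj₂ _ | inj₁ reduction′ = inj₂ (y′ , x′ , fd′ , reduction′)
... | inj₂ obstruction | inj₂ obstruction′ =
      ⊥-elim (obstructions-incompatible {π = π} shat fd fd′ obstruction obstruction′)
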